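{- Let $G=(V,E)$ be a bridgeless cubic graph, let $M$ be a maximal matching of $G$, and let $S$ be the set of vertices of $G$ not incident to any edge of $M$ (an independent set). Then $$\eta(G)\le \frac{|V|-2|S|}{|V|-|S|}.$$
   Context: All graphs are finite, connected and undirected; a bridge is an edge whose removal disconnects its endpoints. A matching is maximal if it is not contained in a larger matching. For a graph $G=(V,E)$ admitting a perfect matching, a weight function is a map $w:E\to\mathbb{R}_{\ge 0}$ that is not identically zero. For $E'\subseteq E$ let $w(E')=\sum_{e\in E'}w(e)$. Let $M^*(G)$ be a maximum weight matching and $P^*(G)$ a maximum weight perfect matching of $G$. Define $\eta(G)=\min_{w} \frac{w(P^*(G))}{w(M^*(G))}$. -}

module Defs where

open import Data.Nat using (ℕ; zero; suc; _+_; _*_; _≤_)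
open import Data.Fin using (Fin; _≟_)
open import Data.Fin.Subset using (Subset; _∈_; _⊆_; ∣_∣)
open import Data.Vec using (Vec; tabulate; sum; zipWith)
open import Data.Bool using (Bool; true; false; if_then_else_)
open import Data.Product using (Σ; ∃; _×_; _,_)
open import Data.Sum using (_⊎_)
open import Data.Empty using (⊥)
open import Data.Unit using (⊤)
open import Relation.Nullary using (¬_; Dec; yes; no)
open import Relation.Binary.PropositionalEquality using (_≡_)

record Graph (n m : ℕ) : Set where
  field
    end₁ end₂ : Fin m → Fin n
    loopless  : ∀ e → ¬ (end₁ e ≡ end₂ e)
    simple    : ∀ e e' →
                ((end₁ e ≡ end₁ e' × end₂ e ≡ end₂ e') ⊎
                 (end₁ e ≡ end₂ e' × end₂ e ≡ end₁ e')) → e ≡ e'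
open Graph public

module _ {n m : ℕ} (G : Graph n m) where

  Incident : Fin n → Fin m → Set
  Incident x e = (end₁ G e ≡ x) ⊎ (end₂ G e ≡ x)

  incident? : Fin n → Fin m → Bool
  incident? x e with end₁ G e ≟ x | end₂ G e ≟ x
  ... | yes _ | _     = true
  ... | no _  | yes _ = true
  ... | no _  | no _  = false

  degree : Fin n → ℕ
  degree x = ∣ tabulate (incident? x) ∣

  Cubic : Set
  Cubic = ∀ x → degree x ≡ 3

  data ConnVia (ok : Fin m → Set) : Fin n → Fin n → Set where
    here  : ∀ {x} → ConnVia ok x x
    step₁ : ∀ {x} e → ok e → ConnVia ok x (end₁ G e) → ConnVia ok x (end₂ G e)
    step₂ : ∀ {x} e → ok e → ConnVia ok x (end₂ G e) → ConnVia ok x (end₁ G e)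

  Connected : Set
  Connected = ∀ x y → ConnVia (λ _ → ⊤) x y

  Bridgeless : Set
  Bridgeless = ∀ e → ConnVia (λ e' → ¬ (e' ≡ e)) (end₁ G e) (end₂ G e)

  IsMatching : Subset m → Set
  IsMatching M = ∀ e e' → e ∈ M → e' ∈ M → ¬ (e ≡ e') →
                 ∀ x → Incident x e → Incident x e' → ⊥

  IsMaximalMatching : Subset m → Set
  IsMaximalMatching M =
    IsMatching M × (∀ M' → IsMatching M' → M ⊆ M' → M' ⊆ M)

  Covered : Subset m → Fin n → Set
  Covered M x = Σ (Fin m) λ e → e ∈ M × Incident x e

  IsPerfectMatching : Subset m → Set
  IsPerfectMatching P = IsMatching P × (∀ x → Covered P x)

  Weight : Set
  Weight = Fin m → ℕ

  NotIdenticallyZero : Weight → Set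
  NotIdenticallyZero w = Σ (Fin m) λ e → ¬ (w e ≡ 0)

  wt : Weight → Subset m → ℕ
  wt w E' = sum (zipWith (λ b k → if b then k else 0) E' (tabulate w))

  IsMaxWeightMatching : Weight → Subset m → Set
  IsMaxWeightMatching w M =
    IsMatching M × (∀ M' → IsMatching M' → wt w M' ≤ wt w M)

  IsMaxWeightPerfectMatching : Weight → Subset m → Set
  IsMaxWeightPerfectMatching w P =
    IsPerfectMatching P × (∀ P' → IsPerfectMatching P' → wt w P' ≤ wt w P)

  -- η(G) ≤ p / q  (q > 0): some admissible weight w has
  -- w(P*(G)) / w(M*(G)) ≤ p / q, i.e. q · w(P*) ≤ p · w(M*)
  EtaLe : ℕ → ℕ → Set
  EtaLe p q = Σ Weight λ w → NotIdenticallyZero w ×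
    (∀ P M → IsMaxWeightPerfectMatching w P → IsMaxWeightMatching w M →
       q * wt w P ≤ p * wt w M)

module Submission where

-- Let M be a maximal matching of a cubic graph G with n vertices, S the set of
-- vertices it leaves uncovered, s = |S| and k = |M|.  We take the weight w = 𝟙_M.
-- Then w(M*) ≥ w(M) = k, and for any perfect matching P, w(P) = a = |M ∩ P|.
-- Write b = |M ─ P|, so k = a + b.
--   * Counting vertices: every vertex lies in S or on exactly one M-edge,
--     so n = s + 2k.
--   * Each x ∈ S is matched by P to a vertex y; by maximality y is covered by
--     an M-edge, which is not in P (it meets the P-edge xy), so y is covered
--     by M ─ P.  Double counting over the edges of P gives s ≤ 2b.
-- Then n - 2s = 2k - s ≥ 2a, so (n - s)·a = 2a·k ≤ (n - 2s)·w(M*), i.e. the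
-- ratio w(P*)/w(M*) for this weight is at most (n - 2s)/(n - s).

open import Defs
open import Data.Nat using (ℕ; zero; suc; _+_; _*_; _∸_; _≤_; _<_; z≤n; s≤s; z<s; _<?_)
open import Data.Nat.Properties hiding (suc-injective; _≟_)
open import Data.Fin using (Fin; zero; suc; _≟_)
open import Data.Fin.Properties using (suc-injective)
open import Data.Fin.Subset using (Subset; _∈_; _∉_; ∣_∣; _∩_; _─_; _∪_; ⁅_⁆)
open import Data.Fin.Subset.Properties
  using (_∈?_; ∩-idem; x∈p∧x∉q⇒x∈p─q; x∈p∪q⁻; p⊆p∪q; q⊆p∪q; x∈⁅x⁆; x∈⁅y⁆⇒x≡y)
open import Data.Vec using ([]; _∷_; lookup; tabulate; zipWith)
import Data.Vec as Vec
open import Data.Vec.Properties using ([]=⇒lookup; lookup⇒[]=)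
open import Data.Bool using (Bool; true; false; if_then_else_)
open import Data.Product using (∃; _×_; _,_; proj₁; proj₂)
open import Data.Sum using (_⊎_; inj₁; inj₂; [_,_]′)
open import Data.Empty using (⊥-elim)
open import Function using (_∘_)
open import Relation.Nullary using (¬_; yes; no; contradiction)
open import Relation.Binary.PropositionalEquality
open import Algebra.Properties.Semiring.Sum +-*-semiring
  using (sum; sum-syntax; sum-cong-≗; sum-replicate-zero; ∑-distrib-+; ∑-comm; *-distribˡ-sum)

≮1⇒≡0 : ∀ {a} → ¬ 0 < a → a ≡ 0
≮1⇒≡0 = n≤0⇒n≡0 ∘ ≮⇒≥

sum-mono : ∀ {n} {f g : Fin n → ℕ} → (∀ i → f i ≤ g i) → sum f ≤ sum g
sum-mono {zero}  f≤g = z≤n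
sum-mono {suc n} f≤g = +-mono-≤ (f≤g zero) (sum-mono (f≤g ∘ suc))

term≤sum : ∀ {n} (f : Fin n → ℕ) i → f i ≤ sum f
term≤sum f zero    = m≤m+n _ _
term≤sum f (suc i) = ≤-trans (term≤sum (f ∘ suc) i) (m≤n+m _ _)

sum-pos : ∀ {n} (f : Fin n → ℕ) → 0 < sum f → ∃ λ i → 0 < f i
sum-pos {suc n} f pos with f zero in eq
... | suc _ = zero , subst (0 <_) (sym eq) z<s
... | zero  = let i , p = sum-pos (f ∘ suc) pos in suc i , p

sum≤1 : ∀ {n} (f : Fin n → ℕ) → (∀ i → f i ≤ 1) →
        (∀ i j → 0 < f i → 0 < f j → i ≡ j) → sum f ≤ 1
sum≤1 {zero}  f bounded unique = z≤n
sum≤1 {suc n} f bounded unique with n≤1⇒n≡0∨n≡1 (bounded zero)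
... | inj₁ f₀≡0 = begin
  f zero + sum (f ∘ suc) ≡⟨ cong (_+ sum (f ∘ suc)) f₀≡0 ⟩
  sum (f ∘ suc)          ≤⟨ sum≤1 (f ∘ suc) (bounded ∘ suc)
                              (λ i j p q → suc-injective (unique _ _ p q)) ⟩
  1                      ∎
  where open ≤-Reasoning
... | inj₂ f₀≡1 = ≤-reflexive (cong₂ _+_ f₀≡1 rest≡0)
  where
  rest-zero : ∀ i → f (suc i) ≡ 0
  rest-zero i = ≮1⇒≡0 λ p →
    contradiction (unique zero (suc i) (≤-reflexive (sym f₀≡1)) p) λ ()
  rest≡0 : sum (f ∘ suc) ≡ 0
  rest≡0 = trans (sum-cong-≗ rest-zero) (sum-replicate-zero n)

sum-ones : ∀ n → ∑[ i < n ] 1 ≡ n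
sum-ones zero    = refl
sum-ones (suc n) = cong suc (sum-ones n)

δ : ∀ {n} → Fin n → Fin n → ℕ
δ zero    zero    = 1
δ zero    (suc _) = 0
δ (suc _) zero    = 0
δ (suc i) (suc j) = δ i j

δ-pos : ∀ {n} (i j : Fin n) → 0 < δ i j → i ≡ j
δ-pos zero    zero    _ = refl
δ-pos (suc i) (suc j) p = cong suc (δ-pos i j p)

δ-refl : ∀ {n} (i : Fin n) → δ i i ≡ 1
δ-refl zero    = refl
δ-refl (suc i) = δ-refl i

δ≤1 : ∀ {n} (i j : Fin n) → δ i j ≤ 1
δ≤1 zero    zero    = s≤s z≤n
δ≤1 zero    (suc j) = z≤n
δ≤1 (suc i) zero    = z≤n
δ≤1 (suc i) (suc j) = δ≤1 i j

sum-δ : ∀ {n} (f : Fin n → ℕ) y → ∑[ x < n ] (f x * δ y x) ≡ f y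
sum-δ {suc n} f zero = trans (cong₂ _+_ (*-identityʳ (f zero))
  (trans (sum-cong-≗ (λ x → *-zeroʳ (f (suc x)))) (sum-replicate-zero n))) (+-identityʳ (f zero))
sum-δ {suc n} f (suc y) =
  cong₂ _+_ (*-zeroʳ (f zero)) (sum-δ (f ∘ suc) y)

𝟙 : Bool → ℕ
𝟙 true  = 1
𝟙 false = 0

𝟙[_] : ∀ {n} → Subset n → Fin n → ℕ
𝟙[ p ] i = 𝟙 (lookup p i)

𝟙≤1 : ∀ {n} (p : Subset n) i → 𝟙[ p ] i ≤ 1
𝟙≤1 p i with lookup p i
... | true  = s≤s z≤n
... | false = z≤n

𝟙-∈ : ∀ {n} {p : Subset n} {i} → i ∈ p → 𝟙[ p ] i ≡ 1
𝟙-∈ i∈p = cong 𝟙 ([]=⇒lookup i∈p)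

𝟙-∉ : ∀ {n} {p : Subset n} {i} → i ∉ p → 𝟙[ p ] i ≡ 0
𝟙-∉ {p = p} {i} i∉p with lookup p i in eq
... | true  = contradiction (lookup⇒[]= i p eq) i∉p
... | false = refl

𝟙-pos : ∀ {n} {p : Subset n} {i} → 0 < 𝟙[ p ] i → i ∈ p
𝟙-pos {p = p} {i} pos with lookup p i in eq
... | true = lookup⇒[]= i p eq

card-sum : ∀ {n} (p : Subset n) → ∣ p ∣ ≡ ∑[ i < n ] 𝟙[ p ] i
card-sum []          = refl
card-sum (true ∷ p)  = cong suc (card-sum p)
card-sum (false ∷ p) = card-sum p

card-split : ∀ {n} (p q : Subset n) → ∣ p ∣ ≡ ∣ p ∩ q ∣ + ∣ p ─ q ∣
card-split []          []          = refl
card-split (true ∷ p)  (true ∷ q)  = cong suc (card-split p q)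
card-split (true ∷ p)  (false ∷ q) =
  trans (cong suc (card-split p q)) (sym (+-suc ∣ p ∩ q ∣ ∣ p ─ q ∣))
card-split (false ∷ p) (true ∷ q)  = card-split p q
card-split (false ∷ p) (false ∷ q) = card-split p q

-- the 𝟙_M-weight of an edge set P (the formula defining wt) is |M ∩ P|
weight-𝟙 : ∀ {m} (M P : Subset m) →
  Vec.sum (zipWith (λ b k → if b then k else 0) P (tabulate 𝟙[ M ])) ≡ ∣ M ∩ P ∣
weight-𝟙 []          []          = refl
weight-𝟙 (true ∷ M)  (true ∷ P)  = cong suc (weight-𝟙 M P)
weight-𝟙 (true ∷ M)  (false ∷ P) = weight-𝟙 M P
weight-𝟙 (false ∷ M) (true ∷ P)  = weight-𝟙 M P
weight-𝟙 (false ∷ M) (false ∷ P) = weight-𝟙 M P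

0<*⁻ : ∀ a b → 0 < a * b → 0 < a × 0 < b
0<*⁻ (suc a) (suc b) _ = z<s , z<s
0<*⁻ (suc a) zero    p = contradiction (subst (0 <_) (*-zeroʳ a) p) λ ()

≤1-* : ∀ {a b} → a ≤ 1 → b ≤ 1 → a * b ≤ 1
≤1-* {zero}     _ _ = z≤n
≤1-* {suc zero} _ q = ≤-trans (≤-reflexive (+-identityʳ _)) q
≤1-* {suc (suc _)} (s≤s ()) _

module _ {n m : ℕ} (G : Graph n m) where

  inc : Fin n → Fin m → ℕ
  inc x e = δ (end₁ G e) x + δ (end₂ G e) x

  inc-pos : ∀ x e → 0 < inc x e → Incident G x e
  inc-pos x e pos with δ (end₁ G e) x in eq
  ... | suc _ = inj₁ (δ-pos _ _ (subst (0 <_) (sym eq) z<s))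
  ... | zero  = inj₂ (δ-pos _ _ pos)

  Incident⇒inc-pos : ∀ x e → Incident G x e → 0 < inc x e
  Incident⇒inc-pos x e (inj₁ refl) =
    ≤-trans (≤-reflexive (sym (δ-refl (end₁ G e)))) (m≤m+n _ _)
  Incident⇒inc-pos x e (inj₂ refl) =
    ≤-trans (≤-reflexive (sym (δ-refl (end₂ G e)))) (m≤n+m _ _)

  -- since G has no loops, a vertex is at most one of the two ends
  inc≤1 : ∀ x e → inc x e ≤ 1
  inc≤1 x e with 0 <? δ (end₁ G e) x
  ... | no ¬pos = subst (λ t → t + δ (end₂ G e) x ≤ 1) (sym (≮1⇒≡0 ¬pos)) (δ≤1 (end₂ G e) x)
  ... | yes pos = subst (λ t → δ (end₁ G e) x + t ≤ 1) (sym (≮1⇒≡0 end₂≢x))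
                        (≤-trans (≤-reflexive (+-identityʳ _)) (δ≤1 (end₁ G e) x))
    where
    end₂≢x : ¬ 0 < δ (end₂ G e) x
    end₂≢x pos₂ = loopless G e (trans (δ-pos _ _ pos) (sym (δ-pos _ _ pos₂)))

  ends-sum : (f : Fin n → ℕ) → ∀ e →
    f (end₁ G e) + f (end₂ G e) ≡ ∑[ x < n ] (f x * inc x e)
  ends-sum f e = begin
    f (end₁ G e) + f (end₂ G e)
      ≡⟨ sym (cong₂ _+_ (sum-δ f (end₁ G e)) (sum-δ f (end₂ G e))) ⟩
    ∑[ x < n ] (f x * δ (end₁ G e) x) + ∑[ x < n ] (f x * δ (end₂ G e) x)
      ≡⟨ sym (∑-distrib-+ (λ x → f x * δ (end₁ G e) x) (λ x → f x * δ (end₂ G e) x)) ⟩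
    ∑[ x < n ] (f x * δ (end₁ G e) x + f x * δ (end₂ G e) x)
      ≡⟨ sum-cong-≗ (λ x → sym (*-distribˡ-+ (f x) _ _)) ⟩
    ∑[ x < n ] (f x * inc x e) ∎
    where open ≡-Reasoning

  deg : Subset m → Fin n → ℕ
  deg Q x = ∑[ e < m ] (𝟙[ Q ] e * inc x e)

  handshake : (f : Fin n → ℕ) (Q : Subset m) →
    ∑[ e < m ] (𝟙[ Q ] e * (f (end₁ G e) + f (end₂ G e))) ≡ ∑[ x < n ] (f x * deg Q x)
  handshake f Q = begin
    ∑[ e < m ] (𝟙[ Q ] e * (f (end₁ G e) + f (end₂ G e)))
      ≡⟨ sum-cong-≗ (λ e → trans (cong (𝟙[ Q ] e *_) (ends-sum f e))
                                 (*-distribˡ-sum (𝟙[ Q ] e) (λ x → f x * inc x e))) ⟩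
    ∑[ e < m ] ∑[ x < n ] (𝟙[ Q ] e * (f x * inc x e))
      ≡⟨ ∑-comm (λ e x → 𝟙[ Q ] e * (f x * inc x e)) ⟩
    ∑[ x < n ] ∑[ e < m ] (𝟙[ Q ] e * (f x * inc x e))
      ≡⟨ sum-cong-≗ (λ x → trans (sum-cong-≗ (λ e → x∘yz≡y∘xz (𝟙[ Q ] e) (f x) (inc x e)))
                                 (sym (*-distribˡ-sum (f x) (λ e → 𝟙[ Q ] e * inc x e)))) ⟩
    ∑[ x < n ] (f x * deg Q x) ∎
    where
    open ≡-Reasoning
    x∘yz≡y∘xz : ∀ a b c → a * (b * c) ≡ b * (a * c)
    x∘yz≡y∘xz a b c = trans (sym (*-assoc a b c))
                        (trans (cong (_* c) (*-comm a b)) (*-assoc b a c))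

  degree-sum : (Q : Subset m) → ∑[ x < n ] deg Q x ≡ 2 * ∣ Q ∣
  degree-sum Q = begin
    ∑[ x < n ] deg Q x                                ≡⟨ sum-cong-≗ (λ x → sym (*-identityˡ (deg Q x))) ⟩
    ∑[ x < n ] (1 * deg Q x)                          ≡⟨ sym (handshake (λ _ → 1) Q) ⟩
    ∑[ e < m ] (𝟙[ Q ] e * 2)                         ≡⟨ sum-cong-≗ (λ e → *-comm (𝟙[ Q ] e) 2) ⟩
    ∑[ e < m ] (2 * 𝟙[ Q ] e)                         ≡⟨ sym (*-distribˡ-sum 2 𝟙[ Q ]) ⟩
    2 * ∑[ e < m ] 𝟙[ Q ] e                           ≡⟨ cong (2 *_) (sym (card-sum Q)) ⟩
    2 * ∣ Q ∣                                         ∎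
    where open ≡-Reasoning

  covered⇒deg-pos : ∀ Q x → Covered G Q x → 0 < deg Q x
  covered⇒deg-pos Q x (e , e∈Q , x∈e) =
    ≤-trans (subst (λ t → 0 < t * inc x e) (sym (𝟙-∈ e∈Q)) (+-monoˡ-≤ 0 (Incident⇒inc-pos x e x∈e)))
            (term≤sum (λ f → 𝟙[ Q ] f * inc x f) e)

  deg-pos⇒covered : ∀ Q x → 0 < deg Q x → Covered G Q x
  deg-pos⇒covered Q x pos =
    let e , term-pos = sum-pos _ pos
        Q-pos , inc-pos' = 0<*⁻ (𝟙[ Q ] e) (inc x e) term-pos
    in e , 𝟙-pos Q-pos , inc-pos x e inc-pos'

  uncovered⇒deg≡0 : ∀ Q x → ¬ Covered G Q x → deg Q x ≡ 0
  uncovered⇒deg≡0 Q x ¬cov = ≮1⇒≡0 (¬cov ∘ deg-pos⇒covered Q x)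

  covered? : ∀ Q x → Covered G Q x ⊎ ¬ Covered G Q x
  covered? Q x with 0 <? deg Q x
  ... | yes pos = inj₁ (deg-pos⇒covered Q x pos)
  ... | no ¬pos = inj₂ (¬pos ∘ covered⇒deg-pos Q x)

  matching⇒deg≤1 : ∀ Q → IsMatching G Q → ∀ x → deg Q x ≤ 1
  matching⇒deg≤1 Q matching x =
    sum≤1 _ (λ e → ≤1-* (𝟙≤1 Q e) (inc≤1 x e)) at-most-one
    where
    at-most-one : ∀ e f → 0 < 𝟙[ Q ] e * inc x e → 0 < 𝟙[ Q ] f * inc x f → e ≡ f
    at-most-one e f pe pf with e ≟ f
    ... | yes e≡f = e≡f
    ... | no  e≢f =
      let e∈Q , e-pos = 0<*⁻ _ _ pe ; f∈Q , f-pos = 0<*⁻ _ _ pf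
      in ⊥-elim (matching e f (𝟙-pos e∈Q) (𝟙-pos f∈Q) e≢f x (inc-pos x e e-pos) (inc-pos x f f-pos))

  perfect⇒deg≡1 : ∀ P → IsPerfectMatching G P → ∀ x → deg P x ≡ 1
  perfect⇒deg≡1 P (matching , covers) x =
    ≤-antisym (matching⇒deg≤1 P matching x) (covered⇒deg-pos P x (covers x))

  perfect-ends-sum : ∀ P → IsPerfectMatching G P → (f : Fin n → ℕ) →
    ∑[ e < m ] (𝟙[ P ] e * (f (end₁ G e) + f (end₂ G e))) ≡ ∑[ x < n ] f x
  perfect-ends-sum P perfect f =
    trans (handshake f P)
          (sum-cong-≗ λ x → trans (cong (f x *_) (perfect⇒deg≡1 P perfect x)) (*-identityʳ (f x)))

  maximal⇒end-covered : ∀ M → IsMaximalMatching G M → ∀ e →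
    Covered G M (end₁ G e) ⊎ Covered G M (end₂ G e)
  maximal⇒end-covered M (matching , maximal) e with covered? M (end₁ G e) | covered? M (end₂ G e)
  ... | inj₁ cov₁ | _         = inj₁ cov₁
  ... | inj₂ _    | inj₁ cov₂ = inj₂ cov₂
  ... | inj₂ ¬cov₁ | inj₂ ¬cov₂ = ⊥-elim (¬cov₁ (e , e∈M , inj₁ refl))
    where
    uncovered : ∀ z → Incident G z e → ¬ Covered G M z
    uncovered z (inj₁ refl) = ¬cov₁
    uncovered z (inj₂ refl) = ¬cov₂
    -- M ∪ {e} is still a matching, hence equal to M
    extended : IsMatching G (M ∪ ⁅ e ⁆)
    extended f f' f∈ f'∈ f≢f' z z∈f z∈f' with x∈p∪q⁻ M ⁅ e ⁆ f∈ | x∈p∪q⁻ M ⁅ e ⁆ f'∈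
    ... | inj₁ f∈M | inj₁ f'∈M = matching f f' f∈M f'∈M f≢f' z z∈f z∈f'
    ... | inj₁ f∈M | inj₂ f'∈e =
      uncovered z (subst (Incident G z) (x∈⁅y⁆⇒x≡y e f'∈e) z∈f') (f , f∈M , z∈f)
    ... | inj₂ f∈e | inj₁ f'∈M =
      uncovered z (subst (Incident G z) (x∈⁅y⁆⇒x≡y e f∈e) z∈f) (f' , f'∈M , z∈f')
    ... | inj₂ f∈e | inj₂ f'∈e = f≢f' (trans (x∈⁅y⁆⇒x≡y e f∈e) (sym (x∈⁅y⁆⇒x≡y e f'∈e)))
    e∈M : e ∈ M
    e∈M = maximal (M ∪ ⁅ e ⁆) extended (p⊆p∪q ⁅ e ⁆) (q⊆p∪q M ⁅ e ⁆ (x∈⁅x⁆ e))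

  -- a vertex covered by M and lying on an edge of the matching P outside M
  -- is covered by M ─ P: its M-edge meets that P-edge, so is not in P
  covered-by-difference : ∀ M P → IsMatching G P → ∀ e → e ∈ P → e ∉ M →
    ∀ y → Incident G y e → Covered G M y → Covered G (M ─ P) y
  covered-by-difference M P P-matching e e∈P e∉M y y∈e (f , f∈M , y∈f) =
    f , x∈p∧x∉q⇒x∈p─q f∈M f∉P , y∈f
    where
    f∉P : f ∉ P
    f∉P f∈P = P-matching f e f∈P e∈P (λ f≡e → e∉M (subst (_∈ M) f≡e f∈M)) y y∈f y∈e

-- a cubic graph with a vertex has an edge (without edges every degree is 0)
some-edge : ∀ {n m} (G : Graph n m) → Cubic G → Fin n → Fin m
some-edge {m = zero}  G cubic x with cubic x
... | ()
some-edge {m = suc _} G cubic x = zero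

module Counting {n m : ℕ} (G : Graph n m) (M : Subset m) (maximalM : IsMaximalMatching G M)
  (S : Subset n) (S-uncovered : ∀ x → (x ∈ S → ¬ Covered G M x) × (¬ Covered G M x → x ∈ S)) where

  vertex-partition : ∀ x → 𝟙[ S ] x + deg G M x ≡ 1
  vertex-partition x with x ∈? S
  ... | yes x∈S = cong₂ _+_ (𝟙-∈ x∈S) (uncovered⇒deg≡0 G M x (proj₁ (S-uncovered x) x∈S))
  ... | no  x∉S = trans (cong (_+ deg G M x) (𝟙-∉ x∉S))
    (≤-antisym (matching⇒deg≤1 G M (proj₁ maximalM) x)
               (covered⇒deg-pos G M x (outside-S⇒covered x∉S)))
    where
    outside-S⇒covered : x ∉ S → Covered G M x
    outside-S⇒covered x∉S with covered? G M x
    ... | inj₁ cov  = cov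
    ... | inj₂ ¬cov = contradiction (proj₂ (S-uncovered x) ¬cov) x∉S

  n≡s+2k : n ≡ ∣ S ∣ + 2 * ∣ M ∣
  n≡s+2k = begin
    n                                          ≡⟨ sym (sum-ones n) ⟩
    ∑[ x < n ] 1                               ≡⟨ sum-cong-≗ (λ x → sym (vertex-partition x)) ⟩
    ∑[ x < n ] (𝟙[ S ] x + deg G M x)          ≡⟨ ∑-distrib-+ 𝟙[ S ] (deg G M) ⟩
    ∑[ x < n ] 𝟙[ S ] x + ∑[ x < n ] deg G M x ≡⟨ cong₂ _+_ (sym (card-sum S)) (degree-sum G M) ⟩
    ∣ S ∣ + 2 * ∣ M ∣                          ∎
    where open ≡-Reasoning

  module _ (P : Subset m) (perfectP : IsPerfectMatching G P) where

    partner-bound : ∀ e → e ∈ P → ∀ x y → Incident G x e → Incident G y e →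
      (¬ Covered G M x → Covered G M y) → 𝟙[ S ] x ≤ deg G (M ─ P) y
    partner-bound e e∈P x y x∈e y∈e other-end with x ∈? S
    ... | no  x∉S = subst (_≤ deg G (M ─ P) y) (sym (𝟙-∉ x∉S)) z≤n
    ... | yes x∈S = ≤-trans (≤-reflexive (𝟙-∈ x∈S)) (covered⇒deg-pos G (M ─ P) y
        (covered-by-difference G M P (proj₁ perfectP) e e∈P e∉M y y∈e
          (other-end x-uncovered)))
      where
      x-uncovered : ¬ Covered G M x
      x-uncovered = proj₁ (S-uncovered x) x∈S
      e∉M : e ∉ M
      e∉M e∈M = x-uncovered (e , e∈M , x∈e)

    edge-bound : ∀ e → 𝟙[ P ] e * (𝟙[ S ] (end₁ G e) + 𝟙[ S ] (end₂ G e))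
                     ≤ 𝟙[ P ] e * (deg G (M ─ P) (end₁ G e) + deg G (M ─ P) (end₂ G e))
    edge-bound e with lookup P e in e-in-P
    ... | false = z≤n
    ... | true  = *-monoʳ-≤ 1
      (≤-trans (+-mono-≤ (partner-bound e (lookup⇒[]= e P e-in-P) (end₁ G e) (end₂ G e)
                                        (inj₁ refl) (inj₂ refl) from-end₁)
                         (partner-bound e (lookup⇒[]= e P e-in-P) (end₂ G e) (end₁ G e)
                                        (inj₂ refl) (inj₁ refl) from-end₂))
               (≤-reflexive (+-comm (deg G (M ─ P) (end₂ G e)) (deg G (M ─ P) (end₁ G e)))))
      where
      from-end₁ : ¬ Covered G M (end₁ G e) → Covered G M (end₂ G e)
      from-end₁ ¬cov with maximal⇒end-covered G M maximalM e
      ... | inj₁ cov = contradiction cov ¬cov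
      ... | inj₂ cov = cov
      from-end₂ : ¬ Covered G M (end₂ G e) → Covered G M (end₁ G e)
      from-end₂ ¬cov with maximal⇒end-covered G M maximalM e
      ... | inj₁ cov = cov
      ... | inj₂ cov = contradiction cov ¬cov

    s≤2b : ∣ S ∣ ≤ 2 * ∣ M ─ P ∣
    s≤2b = begin
      ∣ S ∣                    ≡⟨ card-sum S ⟩
      ∑[ x < n ] 𝟙[ S ] x      ≡⟨ sym (perfect-ends-sum G P perfectP 𝟙[ S ]) ⟩
      ∑[ e < m ] (𝟙[ P ] e * (𝟙[ S ] (end₁ G e) + 𝟙[ S ] (end₂ G e)))
                               ≤⟨ sum-mono edge-bound ⟩
      ∑[ e < m ] (𝟙[ P ] e * (deg G (M ─ P) (end₁ G e) + deg G (M ─ P) (end₂ G e)))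
                               ≡⟨ perfect-ends-sum G P perfectP (deg G (M ─ P)) ⟩
      ∑[ x < n ] deg G (M ─ P) x ≡⟨ degree-sum G (M ─ P) ⟩
      2 * ∣ M ─ P ∣            ∎
      where open ≤-Reasoning

-- The final inequality: with n = s + 2k, k = a + b, s ≤ 2b and k ≤ K we have
-- n - 2s = 2a + (2b - s) ≥ 2a, hence (n - s)·a = 2k·a = 2a·k ≤ (n - 2s)·K.
ratio-bound : ∀ n s k a b K → n ≡ s + 2 * k → k ≡ a + b → s ≤ 2 * b → k ≤ K →
  (n ∸ s) * a ≤ (n ∸ 2 * s) * K
ratio-bound _ s _ a b K refl refl s≤2b k≤K = begin
  (s + 2 * (a + b) ∸ s) * a        ≡⟨ cong (_* a) (m+n∸m≡n s (2 * (a + b))) ⟩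
  2 * (a + b) * a                  ≡⟨ *-comm (2 * (a + b)) a ⟩
  a * (2 * (a + b))                ≡⟨ sym (*-assoc a 2 (a + b)) ⟩
  a * 2 * (a + b)                  ≡⟨ cong (_* (a + b)) (*-comm a 2) ⟩
  2 * a * (a + b)                  ≤⟨ *-mono-≤ 2a≤n∸2s k≤K ⟩
  (s + 2 * (a + b) ∸ 2 * s) * K    ∎
  where
  open ≤-Reasoning
  n∸2s≡2a+[2b∸s] : s + 2 * (a + b) ∸ 2 * s ≡ 2 * a + (2 * b ∸ s)
  n∸2s≡2a+[2b∸s] = begin-equality
    s + 2 * (a + b) ∸ 2 * s        ≡⟨ cong₂ _∸_ (cong (s +_) (*-distribˡ-+ 2 a b))
                                                (cong (s +_) (+-identityʳ s)) ⟩
    s + (2 * a + 2 * b) ∸ (s + s)  ≡⟨ [m+n]∸[m+o]≡n∸o s (2 * a + 2 * b) s ⟩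
    2 * a + 2 * b ∸ s              ≡⟨ +-∸-assoc (2 * a) s≤2b ⟩
    2 * a + (2 * b ∸ s)            ∎
  2a≤n∸2s : 2 * a ≤ s + 2 * (a + b) ∸ 2 * s
  2a≤n∸2s = ≤-trans (m≤m+n (2 * a) (2 * b ∸ s)) (≤-reflexive (sym n∸2s≡2a+[2b∸s]))

-- The weight 𝟙_M witnesses the bound (n = 0 is excluded by 1 ≤ n).
lemma3p4 : ∀ {n m} (G : Graph n m) → 1 ≤ n → Connected G → Cubic G → Bridgeless G →
    (M : Subset m) → IsMaximalMatching G M →
    (S : Subset n) → (∀ x → (x ∈ S → ¬ Covered G M x) × (¬ Covered G M x → x ∈ S)) →
    EtaLe G (n ∸ 2 * ∣ S ∣) (n ∸ ∣ S ∣)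
lemma3p4 {suc n} G _ _ cubic _ M maximalM S S-uncovered = 𝟙[ M ] , nonzero , bound
  where
  open Counting G M maximalM S S-uncovered
  -- some edge has an end covered by M; its M-edge has weight 1
  nonzero : NotIdenticallyZero G 𝟙[ M ]
  nonzero = [ M-edge , M-edge ]′ (maximal⇒end-covered G M maximalM (some-edge G cubic zero))
    where
    M-edge : ∀ {x} → Covered G M x → NotIdenticallyZero G 𝟙[ M ]
    M-edge (f , f∈M , _) = f , λ w≡0 → contradiction (trans (sym (𝟙-∈ f∈M)) w≡0) λ ()
  bound : ∀ P M* → IsMaxWeightPerfectMatching G 𝟙[ M ] P → IsMaxWeightMatching G 𝟙[ M ] M* →
          (suc n ∸ ∣ S ∣) * wt G 𝟙[ M ] P ≤ (suc n ∸ 2 * ∣ S ∣) * wt G 𝟙[ M ] M*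
  -- w(P) = |M ∩ P| = a, and |M| = a + b
  bound P M* (perfectP , _) (_ , M*-max) rewrite weight-𝟙 M P =
    ratio-bound (suc n) (∣ S ∣) (∣ M ∣) (∣ M ∩ P ∣) (∣ M ─ P ∣) _
      n≡s+2k (card-split M P) (s≤2b P perfectP) k≤w[M*]
    where
    -- w(M) = |M ∩ M| = |M| is at most the maximum weight
    k≤w[M*] : ∣ M ∣ ≤ wt G 𝟙[ M ] M*
    k≤w[M*] = ≤-trans (≤-reflexive (trans (cong ∣_∣ (sym (∩-idem M))) (sym (weight-𝟙 M M))))
                      (M*-max M (proj₁ maximalM))
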